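{- Fix a language and a Gödel coding of atomic sentences (with constants for the elements of $\omega$) by natural numbers, so that structures with domain $\omega$ are identified with their atomic diagrams in $2^\omega$. Let $\mathfrak{C}\subseteq 2^\omega$ be a class of such atomic diagrams which is closed under isomorphism, with the subspace topology from Cantor space, and give $\mathfrak{C}/\!\cong$ the quotient topology. Then for each structure $\mathcal{D}$ with atomic diagram $D\in\mathfrak{C}$, the singleton $\{[D]\}$ is open in $\mathfrak{C}/\!\cong$ if and only if there is a finitary $\Sigma_1$ sentence $\exists\vec{x}\,\alpha(\vec x)$ (with $\alpha$ quantifier-free) in the language which is a Scott sentence for $\mathcal{D}$ within $\mathfrak{C}$, i.e., for every structure $\mathcal{C}$ whose atomic diagram lies in $\mathfrak{C}$, $\mathcal{C}\models\exists\vec x\,\alpha$ if and only if $\mathcal{C}\cong\mathcal{D}$.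
   Context: $[D]$ denotes the isomorphism class of the structure with atomic diagram $D$. A set in $\mathfrak{C}/\!\cong$ is open iff its preimage under $D\mapsto[D]$ is open in $\mathfrak{C}$, whose basic open sets are $\{D\in\mathfrak{C}:\sigma\subset D\}$ for $\sigma\in 2^{<\omega}$. -}

module Defs where

open import Data.Nat using (ℕ; zero; suc)
open import Data.Bool using (Bool; true)
open import Data.Fin using (Fin)
open import Data.Vec using (Vec; map)
open import Data.List using (List; []; _∷_)
open import Data.Unit using (⊤)
open import Data.Product using (Σ; _×_; ∃; ∃-syntax)
open import Data.Sum using (_⊎_)
open import Relation.Nullary using (¬_)
open import Relation.Binary.PropositionalEquality using (_≡_)
open import Function.Bundles using (_↔_; Inverse)

record Language : Set₁ where
  field
    Sym : Set
    ar  : Sym → ℕ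

module _ (L : Language) where
  open Language L

  -- Atomic sentences R(c_{a₁},…,c_{aₖ}) with constants for elements of ω.
  AtomSent : Set
  AtomSent = Σ Sym (λ R → Vec ℕ (ar R))

GödelCoding : Language → Set
GödelCoding L = AtomSent L ↔ ℕ

Cantor : Set
Cantor = ℕ → Bool

CSet : Set₁
CSet = Cantor → Set

_⊂_ : List Bool → Cantor → Set
[] ⊂ D = ⊤
(b ∷ σ) ⊂ D = (b ≡ D 0) × (σ ⊂ (λ n → D (suc n)))

-- Open sets of Cantor space: unions of basic open sets [σ] = {D : σ ⊂ D}.
IsOpenCantor : CSet → Set₁
IsOpenCantor O = Σ (List Bool → Set) λ W →
  ∀ X → ((O X → Σ (List Bool) λ σ → W σ × σ ⊂ X)
        × ((Σ (List Bool) λ σ → W σ × σ ⊂ X) → O X))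

IsOpenIn : CSet → CSet → Set₁
IsOpenIn 𝔠 S = Σ CSet λ O → IsOpenCantor O ×
  (∀ X → 𝔠 X → (S X → O X) × (O X → S X))

module _ {L : Language} (code : GödelCoding L) where
  open Language L
  open Inverse code renaming (to to enc)

  Holds : Cantor → (R : Sym) → Vec ℕ (ar R) → Set
  Holds D R as = D (enc (R Data.Product., as)) ≡ true

  _≅_ : Cantor → Cantor → Set
  D ≅ E = Σ (ℕ ↔ ℕ) λ f → ∀ (R : Sym) (as : Vec ℕ (ar R)) →
    D (enc (R Data.Product., as)) ≡ E (enc (R Data.Product., map (Inverse.to f) as))

  IsoClosed : CSet → Set
  IsoClosed 𝔠 = ∀ D E → 𝔠 D → D ≅ E → 𝔠 E

  -- Sets in 𝔠/≅ are given by their preimages; a set of classes is open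
  -- in the quotient topology iff its preimage is open in 𝔠.
  -- The preimage of the singleton {[D]} is {E ∈ 𝔠 : E ≅ D}.
  SingletonOpenInQuotient : CSet → Cantor → Set₁
  SingletonOpenInQuotient 𝔠 D = IsOpenIn 𝔠 (λ E → E ≅ D)

  data QF (n : ℕ) : Set where
    rel  : (R : Sym) → Vec (Fin n) (ar R) → QF n
    eq   : Fin n → Fin n → QF n
    neg  : QF n → QF n
    conj : QF n → QF n → QF n
    disj : QF n → QF n → QF n

  Sat : Cantor → {n : ℕ} → (Vec ℕ n) → QF n → Set
  Sat D ρ (rel R xs) = Holds D R (map (λ i → Data.Vec.lookup ρ i) xs)
  Sat D ρ (eq i j)   = Data.Vec.lookup ρ i ≡ Data.Vec.lookup ρ j
  Sat D ρ (neg φ)    = ¬ Sat D ρ φ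
  Sat D ρ (conj φ ψ) = Sat D ρ φ × Sat D ρ ψ
  Sat D ρ (disj φ ψ) = Sat D ρ φ ⊎ Sat D ρ ψ

  ModelsΣ₁ : Cantor → {n : ℕ} → QF n → Set
  ModelsΣ₁ C {n} α = Σ (Vec ℕ n) λ ρ → Sat C ρ α

  ScottWithin : CSet → Cantor → {n : ℕ} → QF n → Set
  ScottWithin 𝔠 D α = ∀ C → 𝔠 C → (ModelsΣ₁ C α → C ≅ D) × (C ≅ D → ModelsΣ₁ C α)

{-# OPTIONS --safe #-}

-- Whether α(ρ) holds in X is decided by finitely many bits of X, so a Σ₁ sentence defines an
-- open set, and a Σ₁ Scott sentence makes the isomorphism class of D open. Conversely, if the
-- class is open in 𝔠, some initial segment σ ⊂ D forces it within 𝔠. Let M bound the constants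
-- of the atomic sentences coded below |σ|, and let α(x₀,…,x_M) say that the xᵢ are distinct and
-- satisfy exactly those of these atoms (with xₑ for the constant e) that hold in D. Then D ⊨ α(0,…,M);
-- and if C ⊨ α(ρ), relabelling C along a permutation of ω sending i to ρᵢ gives an isomorphic
-- copy extending σ, which lies in 𝔠 by isomorphism closure and is therefore isomorphic to D.
module Submission where

open import Defs
open import Data.Nat using (ℕ)
open import Data.Product using (Σ; _×_)

open import Data.Bool using (Bool; true; false)
open import Data.Bool.Properties using (¬-not; not-¬)
open import Data.Fin using (Fin; zero; suc; toℕ; fromℕ<)
open import Data.Fin.Properties using (_≟_; 0≢1+n; suc-injective; toℕ-injective; toℕ-fromℕ<; toℕ<n; ∀-cons-⇔)
open import Data.List using (List; []; _∷_; length; applyUpTo)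
open import Data.List.Properties using (length-applyUpTo)
open import Data.Nat as ℕ using (_≤_; _<_; _⊔_; s≤s)
open import Data.Nat.DivMod using (_mod_; m<n⇒m%n≡m)
open import Data.Nat.Properties using (≤-refl; ≤-trans; m≤m⊔n; m≤n⊔m; m⊔n≤o⇒m≤o; m⊔n≤o⇒n≤o; m<1+n⇒m<n∨m≡n)
open import Data.Product using (_,_; proj₁; proj₂; swap)
open import Data.Product.Function.NonDependent.Propositional using (_×-⇔_)
open import Data.Sum using (inj₁; inj₂)
open import Data.Sum.Function.Propositional using (_⊎-⇔_)
open import Data.Unit using (tt)
open import Data.Vec using (Vec; []; _∷_; lookup; map; tabulate)
open import Data.Vec.Properties using (map-id; map-∘; map-cong; lookup-map; lookup∘tabulate)
open import Function using (id; _∘_)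
open import Function.Bundles using (_↔_; _⇔_; Inverse; Injection; Equivalence; mk↔ₛ′; mk⇔)
open import Function.Construct.Composition using (_⇔-∘_)
open import Function.Construct.Identity using (⇔-id)
open import Function.Definitions using (Injective)
open import Function.Properties.Inverse using (↔-refl; ↔-sym; ↔-trans; ↔⇒↣)
open import Function.Related.TypeIsomorphisms using (¬-cong-⇔)
open import Relation.Binary.Definitions using (DecidableEquality)
open import Relation.Binary.PropositionalEquality
  using (_≡_; _≢_; refl; sym; trans; cong; cong₂; subst; subst₂; module ≡-Reasoning)
open import Relation.Nullary using (yes; no; contradiction)

module ↔ = Inverse
module ⇔ = Equivalence

↔-≡-⇔ : ∀ {a b} {A : Set a} {B : Set b} (f : A ↔ B) {x y} → x ≡ y ⇔ ↔.to f x ≡ ↔.to f y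
↔-≡-⇔ f = mk⇔ (cong (↔.to f)) (Injection.injective (↔⇒↣ f))

module _ {a} {A : Set a} (_≟_ : DecidableEquality A) where

  transpose : A → A → A → A
  transpose x y z with z ≟ x
  ... | yes _ = y
  ... | no _ with z ≟ y
  ...   | yes _ = x
  ...   | no _ = z

  transpose-left : ∀ x y → transpose x y x ≡ y
  transpose-left x y with x ≟ x
  ... | yes _ = refl
  ... | no x≢x = contradiction refl x≢x

  transpose-right : ∀ x y → transpose x y y ≡ x
  transpose-right x y with y ≟ x
  ... | yes y≡x = y≡x
  ... | no _ with y ≟ y
  ...   | yes _ = refl
  ...   | no y≢y = contradiction refl y≢y

  transpose-other : ∀ {x y z} → z ≢ x → z ≢ y → transpose x y z ≡ z
  transpose-other {x} {y} {z} z≢x z≢y with z ≟ x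
  ... | yes z≡x = contradiction z≡x z≢x
  ... | no _ with z ≟ y
  ...   | yes z≡y = contradiction z≡y z≢y
  ...   | no _ = refl

  transpose-involutive : ∀ x y z → transpose x y (transpose x y z) ≡ z
  transpose-involutive x y z with z ≟ x
  ... | yes refl = transpose-right x y
  ... | no z≢x with z ≟ y
  ...   | yes refl = transpose-left x y
  ...   | no z≢y = transpose-other z≢x z≢y

  transpose-↔ : A → A → A ↔ A
  transpose-↔ x y =
    mk↔ₛ′ (transpose x y) (transpose x y) (transpose-involutive x y) (transpose-involutive x y)

  permutation-sending : ∀ {n} (a b : Fin n → A) → Injective _≡_ _≡_ a → Injective _≡_ _≡_ b →
                        Σ (A ↔ A) λ π → ∀ i → ↔.to π (a i) ≡ b i
  permutation-sending {ℕ.zero} a b _ _ = ↔-refl , λ ()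
  permutation-sending {ℕ.suc n} a b a-inj b-inj =
    ↔-trans π (transpose-↔ (b zero) (↔.to π (a zero))) , sends
    where
    tail = permutation-sending (a ∘ suc) (b ∘ suc) (suc-injective ∘ a-inj) (suc-injective ∘ b-inj)
    π = proj₁ tail

    sends : ∀ i → transpose (b zero) (↔.to π (a zero)) (↔.to π (a i)) ≡ b i
    sends zero = transpose-right (b zero) (↔.to π (a zero))
    sends (suc i) = trans (cong (transpose _ _) (proj₂ tail i)) (transpose-other b₀-fresh a₀-fresh)
      where
      b₀-fresh : b (suc i) ≢ b zero
      b₀-fresh = 0≢1+n ∘ sym ∘ b-inj
      a₀-fresh : b (suc i) ≢ ↔.to π (a zero)
      a₀-fresh e = 0≢1+n (a-inj (⇔.from (↔-≡-⇔ π) (trans (sym e) (sym (proj₂ tail i)))))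

maxᵥ : ∀ {n} → Vec ℕ n → ℕ
maxᵥ [] = 0
maxᵥ (x ∷ xs) = x ⊔ maxᵥ xs

map-cong-≤ : ∀ {b} {B : Set b} {f g : ℕ → B} {M n} → (∀ {e} → e ≤ M → f e ≡ g e) →
             (xs : Vec ℕ n) → maxᵥ xs ≤ M → map f xs ≡ map g xs
map-cong-≤ f≗g [] _ = refl
map-cong-≤ f≗g (x ∷ xs) bound =
  cong₂ _∷_ (f≗g (m⊔n≤o⇒m≤o x _ bound)) (map-cong-≤ f≗g xs (m⊔n≤o⇒n≤o x _ bound))

map-inverseˡ : ∀ {a b} {A : Set a} {B : Set b} (f : A ↔ B) {n} (ys : Vec B n) →
               map (↔.to f) (map (↔.from f) ys) ≡ ys
map-inverseˡ f ys = begin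
  map (↔.to f) (map (↔.from f) ys) ≡⟨ map-∘ (↔.to f) (↔.from f) ys ⟨
  map (↔.to f ∘ ↔.from f) ys       ≡⟨ map-cong (↔.strictlyInverseˡ f) ys ⟩
  map id ys                        ≡⟨ map-id ys ⟩
  ys                               ∎
  where open ≡-Reasoning

map-lookup-map : ∀ {a b} {A : Set a} {B : Set b} (f : A → B) {m n} (ρ : Vec A m) (xs : Vec (Fin m) n) →
                 map (lookup (map f ρ)) xs ≡ map f (map (lookup ρ) xs)
map-lookup-map f ρ xs = trans (map-cong (λ i → lookup-map i f ρ) xs) (map-∘ f (lookup ρ) xs)

AgreeBelow : ℕ → Cantor → Cantor → Set
AgreeBelow N X Y = ∀ {k} → k < N → X k ≡ Y k

AgreeBelow-mono : ∀ {M N X Y} → M ≤ N → AgreeBelow N X Y → AgreeBelow M X Y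
AgreeBelow-mono M≤N agree k<M = agree (≤-trans k<M M≤N)

applyUpTo-⊂ : ∀ X N → applyUpTo X N ⊂ X
applyUpTo-⊂ X ℕ.zero = tt
applyUpTo-⊂ X (ℕ.suc N) = refl , applyUpTo-⊂ (X ∘ ℕ.suc) N

⊂-agree : ∀ σ {X Y} → σ ⊂ X → σ ⊂ Y → AgreeBelow (length σ) X Y
⊂-agree (b ∷ σ) (b≡X₀ , _) (b≡Y₀ , _) {ℕ.zero} _ = trans (sym b≡X₀) b≡Y₀
⊂-agree (b ∷ σ) (_ , σ⊂X) (_ , σ⊂Y) {ℕ.suc k} (s≤s k<N) = ⊂-agree σ σ⊂X σ⊂Y k<N

agree-⊂ : ∀ σ {X Y} → σ ⊂ X → AgreeBelow (length σ) X Y → σ ⊂ Y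
agree-⊂ [] _ _ = tt
agree-⊂ (b ∷ σ) (b≡X₀ , σ⊂X) agree =
  trans b≡X₀ (agree (s≤s ℕ.z≤n)) , agree-⊂ σ σ⊂X (λ k<N → agree (s≤s k<N))

applyUpTo-⊂⇒agree : ∀ {X Y} N → applyUpTo X N ⊂ Y → AgreeBelow N X Y
applyUpTo-⊂⇒agree {X} N p =
  subst (λ n → AgreeBelow n X _) (length-applyUpTo X N) (⊂-agree (applyUpTo X N) (applyUpTo-⊂ X N) p)

basic-neighbourhood : ∀ {𝔠 S : CSet} {D} → IsOpenIn 𝔠 S → 𝔠 D → S D →
                      Σ (List Bool) λ σ → σ ⊂ D × (∀ X → 𝔠 X → σ ⊂ X → S X)
basic-neighbourhood (_ , (_ , O-open) , S≡O∩𝔠) 𝔠D SD with proj₁ (O-open _) (proj₁ (S≡O∩𝔠 _ 𝔠D) SD)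
... | σ , Wσ , σ⊂D = σ , σ⊂D , λ X 𝔠X σ⊂X → proj₂ (S≡O∩𝔠 X 𝔠X) (proj₂ (O-open X) (σ , Wσ , σ⊂X))

module _ {L : Language} (code : GödelCoding L) where
  open Language L
  open Inverse code using ()
    renaming (to to enc; from to dec; strictlyInverseˡ to enc∘dec; strictlyInverseʳ to dec∘enc)

  private
    infix 4 _≃_
    _≃_ : Cantor → Cantor → Set
    _≃_ = _≅_ code

  ≃-refl : ∀ {C} → C ≃ C
  ≃-refl {C} = ↔-refl , λ R as → cong (λ bs → C (enc (R , bs))) (sym (map-id as))

  ≃-sym : ∀ {C E} → C ≃ E → E ≃ C
  ≃-sym {C} {E} (f , h) = ↔-sym f , λ R as →
    sym (trans (h R (map (↔.from f) as)) (cong (λ bs → E (enc (R , bs))) (map-inverseˡ f as)))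

  ≃-trans : ∀ {C E G} → C ≃ E → E ≃ G → C ≃ G
  ≃-trans {G = G} (f , hf) (g , hg) = ↔-trans f g , λ R as →
    trans (hf R as) (trans (hg R (map (↔.to f) as))
                           (cong (λ bs → G (enc (R , bs))) (sym (map-∘ (↔.to g) (↔.to f) as))))

  Sat-≃ : ∀ {C E} (iso : C ≃ E) {n} (ρ : Vec ℕ n) (φ : QF code n) →
          Sat code C ρ φ ⇔ Sat code E (map (↔.to (proj₁ iso)) ρ) φ
  Sat-≃ {C} {E} (f , h) ρ (rel R xs) = mk⇔ (trans (sym same-bit)) (trans same-bit)
    where
    same-bit : C (enc (R , map (lookup ρ) xs)) ≡ E (enc (R , map (lookup (map (↔.to f) ρ)) xs))
    same-bit = trans (h R _) (cong (λ bs → E (enc (R , bs))) (sym (map-lookup-map (↔.to f) ρ xs)))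
  Sat-≃ (f , _) ρ (eq i j) =
    subst₂ (λ u v → (lookup ρ i ≡ lookup ρ j) ⇔ (u ≡ v))
           (sym (lookup-map i (↔.to f) ρ)) (sym (lookup-map j (↔.to f) ρ)) (↔-≡-⇔ f)
  Sat-≃ iso ρ (neg φ) = ¬-cong-⇔ (Sat-≃ iso ρ φ)
  Sat-≃ iso ρ (conj φ ψ) = Sat-≃ iso ρ φ ×-⇔ Sat-≃ iso ρ ψ
  Sat-≃ iso ρ (disj φ ψ) = Sat-≃ iso ρ φ ⊎-⇔ Sat-≃ iso ρ ψ

  ModelsΣ₁-≃ : ∀ {C E n} {α : QF code n} → C ≃ E → ModelsΣ₁ code C α → ModelsΣ₁ code E α
  ModelsΣ₁-≃ {α = α} iso (ρ , sat) = map _ ρ , ⇔.to (Sat-≃ iso ρ α) sat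

  relabel : (ℕ → ℕ) → Cantor → Cantor
  relabel g C k = C (enc (proj₁ (dec k) , map g (proj₂ (dec k))))

  relabel-id : ∀ C k → relabel id C k ≡ C k
  relabel-id C k = cong C (trans (cong (λ bs → enc (proj₁ (dec k) , bs)) (map-id _)) (enc∘dec k))

  relabel-≃ : ∀ (π : ℕ ↔ ℕ) C → relabel (↔.to π) C ≃ C
  relabel-≃ π C = π , λ R as → cong (λ (S , bs) → C (enc (S , map (↔.to π) bs))) (dec∘enc (R , as))

  use : ∀ {n} → Vec ℕ n → QF code n → ℕ
  use ρ (rel R xs) = ℕ.suc (enc (R , map (lookup ρ) xs))
  use ρ (eq _ _) = 0
  use ρ (neg φ) = use ρ φ
  use ρ (conj φ ψ) = use ρ φ ⊔ use ρ ψ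
  use ρ (disj φ ψ) = use ρ φ ⊔ use ρ ψ

  Sat-local : ∀ {X Y n} (ρ : Vec ℕ n) (φ : QF code n) → AgreeBelow (use ρ φ) X Y →
              Sat code X ρ φ ⇔ Sat code Y ρ φ
  Sat-local ρ (rel R xs) agree = mk⇔ (trans (sym (agree ≤-refl))) (trans (agree ≤-refl))
  Sat-local ρ (eq _ _) _ = ⇔-id _
  Sat-local ρ (neg φ) agree = ¬-cong-⇔ (Sat-local ρ φ agree)
  Sat-local ρ (conj φ ψ) agree =
    Sat-local ρ φ (AgreeBelow-mono (m≤m⊔n _ _) agree) ×-⇔
    Sat-local ρ ψ (AgreeBelow-mono (m≤n⊔m _ _) agree)
  Sat-local ρ (disj φ ψ) agree =
    Sat-local ρ φ (AgreeBelow-mono (m≤m⊔n _ _) agree) ⊎-⇔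
    Sat-local ρ ψ (AgreeBelow-mono (m≤n⊔m _ _) agree)

  Σ₁-open : ∀ {n} (α : QF code n) → IsOpenCantor (λ X → ModelsΣ₁ code X α)
  Σ₁-open {n} α = W , λ X → neighbourhood X , λ (σ , (ρ , forced) , σ⊂X) → ρ , forced X σ⊂X
    where
    W : List Bool → Set
    W σ = Σ (Vec ℕ n) λ ρ → ∀ Y → σ ⊂ Y → Sat code Y ρ α

    neighbourhood : ∀ X → ModelsΣ₁ code X α → Σ (List Bool) λ σ → W σ × σ ⊂ X
    neighbourhood X (ρ , sat) =
      applyUpTo X (use ρ α) ,
      (ρ , λ Y p → ⇔.to (Sat-local ρ α (applyUpTo-⊂⇒agree (use ρ α) p)) sat) ,
      applyUpTo-⊂ X (use ρ α)

  Σ₁-Scott⇒open : ∀ {𝔠 D n} {α : QF code n} → ScottWithin code 𝔠 D α → SingletonOpenInQuotient code 𝔠 D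
  Σ₁-Scott⇒open {α = α} scott = _ , Σ₁-open α , λ X 𝔠X → swap (scott X 𝔠X)

  ⊤ᶠ : ∀ {n} → QF code (ℕ.suc n)
  ⊤ᶠ = eq zero zero

  ⋀ : ∀ {m n} → (Fin m → QF code (ℕ.suc n)) → QF code (ℕ.suc n)
  ⋀ {ℕ.zero} φs = ⊤ᶠ
  ⋀ {ℕ.suc m} φs = conj (φs zero) (⋀ (φs ∘ suc))

  Sat-⋀ : ∀ {C m n} (ρ : Vec ℕ (ℕ.suc n)) (φs : Fin m → QF code (ℕ.suc n)) →
          Sat code C ρ (⋀ φs) ⇔ (∀ i → Sat code C ρ (φs i))
  Sat-⋀ {m = ℕ.zero} ρ φs = mk⇔ (λ _ ()) (λ _ → refl)
  Sat-⋀ {m = ℕ.suc m} ρ φs = ∀-cons-⇔ ⇔-∘ (⇔-id _ ×-⇔ Sat-⋀ ρ (φs ∘ suc))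

  distinctPair : ∀ {n} → Fin n → Fin n → QF code n
  distinctPair i j with i ≟ j
  ... | yes _ = eq i j
  ... | no _ = neg (eq i j)

  Sat-distinctPair : ∀ {C n} (ρ : Vec ℕ n) i j →
                     Sat code C ρ (distinctPair i j) ⇔ (lookup ρ i ≡ lookup ρ j → i ≡ j)
  Sat-distinctPair ρ i j with i ≟ j
  ... | yes i≡j = mk⇔ (λ _ _ → i≡j) (λ _ → cong (lookup ρ) i≡j)
  ... | no i≢j = mk⇔ (λ ρi≢ρj ρi≡ρj → contradiction ρi≡ρj ρi≢ρj) (λ inj ρi≡ρj → i≢j (inj ρi≡ρj))

  distinct : ∀ {n} → QF code (ℕ.suc n)
  distinct = ⋀ λ i → ⋀ λ j → distinctPair i j

  Sat-distinct : ∀ {C n} (ρ : Vec ℕ (ℕ.suc n)) → Sat code C ρ distinct ⇔ Injective _≡_ _≡_ (lookup ρ)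
  Sat-distinct ρ = mk⇔
    (λ sat {i} {j} →
       ⇔.to (Sat-distinctPair ρ i j) (⇔.to (Sat-⋀ ρ (distinctPair i)) (⇔.to (Sat-⋀ ρ rows) sat i) j))
    (λ inj → ⇔.from (Sat-⋀ ρ rows) λ i →
             ⇔.from (Sat-⋀ ρ (distinctPair i)) λ j → ⇔.from (Sat-distinctPair ρ i j) inj)
    where rows = λ i → ⋀ (distinctPair i)

  literal : ∀ {n} → Bool → QF code n → QF code n
  literal true φ = φ
  literal false φ = neg φ

  Sat-literal : ∀ {C n} (ρ : Vec ℕ n) b R (xs : Vec (Fin n) (ar R)) →
                Sat code C ρ (literal b (rel R xs)) ⇔ (C (enc (R , map (lookup ρ) xs)) ≡ b)
  Sat-literal ρ true _ _ = ⇔-id _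
  Sat-literal ρ false _ _ = mk⇔ ¬-not not-¬

  args : (k : ℕ) → Vec ℕ (ar (proj₁ (dec k)))
  args k = proj₂ (dec k)

  support : ℕ → ℕ
  support ℕ.zero = 0
  support (ℕ.suc N) = maxᵥ (args N) ⊔ support N

  args≤support : ∀ {k N} → k < N → maxᵥ (args k) ≤ support N
  args≤support {k} {ℕ.suc N} k<1+N with m<1+n⇒m<n∨m≡n k<1+N
  ... | inj₁ k<N = ≤-trans (args≤support k<N) (m≤n⊔m _ _)
  ... | inj₂ refl = m≤m⊔n _ _

  -- the variable xₑ for the constant e; faithful only for e ≤ M, beyond that it wraps around
  var : (M e : ℕ) → Fin (ℕ.suc M)
  var M e = e mod ℕ.suc M

  toℕ-var : ∀ {M e} → e ≤ M → toℕ (var M e) ≡ e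
  toℕ-var e≤M = trans (toℕ-fromℕ< _) (m<n⇒m%n≡m (s≤s e≤M))

  module _ (N : ℕ) where

    atom : ℕ → QF code (ℕ.suc (support N))
    atom k = rel (proj₁ (dec k)) (map (var (support N)) (args k))

    diagram : Cantor → QF code (ℕ.suc (support N))
    diagram D = conj distinct (⋀ λ (k : Fin N) → literal (D (toℕ k)) (atom (toℕ k)))

    atom-bit : ∀ C (ρ : Vec ℕ (ℕ.suc (support N))) {g : ℕ → ℕ} →
               (∀ {e} → e ≤ support N → lookup ρ (var (support N) e) ≡ g e) →
               ∀ {k} → k < N →
               C (enc (proj₁ (dec k) , map (lookup ρ) (map (var (support N)) (args k)))) ≡ relabel g C k
    atom-bit C ρ ρ≈g {k} k<N = cong (λ bs → C (enc (proj₁ (dec k) , bs)))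
      (trans (sym (map-∘ (lookup ρ) (var (support N)) (args k)))
             (map-cong-≤ ρ≈g (args k) (args≤support k<N)))

    diagram-self : ∀ D → Sat code D (tabulate toℕ) (diagram D)
    diagram-self D =
      ⇔.from (Sat-distinct ρ₀) ρ₀-injective ,
      ⇔.from (Sat-⋀ ρ₀ _) λ k →
        ⇔.from (Sat-literal ρ₀ _ _ _) (trans (atom-bit D ρ₀ ρ₀-var (toℕ<n k)) (relabel-id D (toℕ k)))
      where
      ρ₀ = tabulate toℕ
      ρ₀-injective : Injective _≡_ _≡_ (lookup ρ₀)
      ρ₀-injective {i} {j} e =
        toℕ-injective (trans (sym (lookup∘tabulate toℕ i)) (trans e (lookup∘tabulate toℕ j)))
      ρ₀-var : ∀ {e} → e ≤ support N → lookup ρ₀ (var (support N) e) ≡ e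
      ρ₀-var e≤M = trans (lookup∘tabulate toℕ _) (toℕ-var e≤M)

    diagram-realised : ∀ {C D} (ρ : Vec ℕ (ℕ.suc (support N))) → Sat code C ρ (diagram D) →
                       Σ (ℕ ↔ ℕ) λ π → AgreeBelow N D (relabel (↔.to π) C)
    diagram-realised {C} {D} ρ (distinct-sat , literals-sat) = π , agree
      where
      π-sends = permutation-sending ℕ._≟_ toℕ (lookup ρ) toℕ-injective (⇔.to (Sat-distinct ρ) distinct-sat)
      π = proj₁ π-sends

      π-var : ∀ {e} → e ≤ support N → lookup ρ (var (support N) e) ≡ ↔.to π e
      π-var e≤M = trans (sym (proj₂ π-sends _)) (cong (↔.to π) (toℕ-var e≤M))

      literal-sat : ∀ {k} → k < N → Sat code C ρ (literal (D k) (atom k))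
      literal-sat k<N = subst (λ k → Sat code C ρ (literal (D k) (atom k))) (toℕ-fromℕ< k<N)
                              (⇔.to (Sat-⋀ ρ _) literals-sat (fromℕ< k<N))

      agree : AgreeBelow N D (relabel (↔.to π) C)
      agree k<N = trans (sym (⇔.to (Sat-literal ρ _ _ _) (literal-sat k<N))) (atom-bit C ρ π-var k<N)

  open⇒Σ₁-Scott : ∀ {𝔠} → IsoClosed code 𝔠 → ∀ {D} → 𝔠 D → SingletonOpenInQuotient code 𝔠 D →
                  Σ ℕ λ n → Σ (QF code n) λ α → ScottWithin code 𝔠 D α
  open⇒Σ₁-Scott {𝔠} closed {D} 𝔠D class-open with basic-neighbourhood class-open 𝔠D (≃-refl {D})
  ... | σ , σ⊂D , [σ]⊆class = _ , diagram (length σ) D , λ C 𝔠C → realised⇒≃ C 𝔠C , ≃⇒realised C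
    where
    realised⇒≃ : ∀ C → 𝔠 C → ModelsΣ₁ code C (diagram (length σ) D) → C ≃ D
    realised⇒≃ C 𝔠C (ρ , sat) with diagram-realised (length σ) {C} {D} ρ sat
    ... | π , agree =
      ≃-trans {C} {C′} {D} C≃C′ ([σ]⊆class C′ (closed C C′ 𝔠C C≃C′) (agree-⊂ σ σ⊂D agree))
      where
      C′ = relabel (↔.to π) C
      C≃C′ = ≃-sym {C′} {C} (relabel-≃ π C)

    ≃⇒realised : ∀ C → C ≃ D → ModelsΣ₁ code C (diagram (length σ) D)
    ≃⇒realised C C≃D =
      ModelsΣ₁-≃ {D} {C} {α = diagram (length σ) D} (≃-sym {C} {D} C≃D) (_ , diagram-self (length σ) D)

proposition3p4 : (L : Language) (code : GödelCoding L) (𝔠 : CSet) →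
    IsoClosed code 𝔠 → (D : Cantor) → 𝔠 D →
    (SingletonOpenInQuotient code 𝔠 D → Σ ℕ (λ n → Σ (QF code n) (λ α → ScottWithin code 𝔠 D α)))
    × (Σ ℕ (λ n → Σ (QF code n) (λ α → ScottWithin code 𝔠 D α)) → SingletonOpenInQuotient code 𝔠 D)
proposition3p4 _ code 𝔠 closed D 𝔠D =
  open⇒Σ₁-Scott code closed 𝔠D , λ (_ , _ , scott) → Σ₁-Scott⇒open code {𝔠} {D} scott
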